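{- Let $n\ge 1$ and $N\ge M\ge 1$ be integers and let $A=\{\mathbf a_1,\dots,\mathbf a_N\}\subseteq\mathbb Z^n$, where each $\mathbf a_j=(a_{1j},\dots,a_{n-1,j},1)$ has last coordinate $1$. Put $\beta=\sum_{j=1}^M\mathbf a_j$ and assume that $A'=\{\mathbf a_1,\dots,\mathbf a_M\}$ is minimal for $\sigma_\beta^\circ$. If \[M=\min\{ -u_n\mid u=(u_1,\dots,u_n)\in\mathcal M_\beta\text{ and }F_u(\Lambda)\neq 0\},\] then for every $u\in\mathcal M_\beta$ the series $F_u(\Lambda)$ has integral coefficients.
   Context: $\mathbb N$ denotes the nonnegative integers. $C(A)\subseteq\mathbb R^n$ is the real cone generated by $A$; $\sigma_\beta$ is the smallest closed face of $C(A)$ containing $\beta$, and $\sigma_\beta^\circ$ is its relative interior ($\sigma_\beta$ minus all its proper closed subfaces). $A'$ is minimal for $\sigma_\beta^\circ$ if for every proper subset $J\subsetneq\{1,\dots,M\}$, $\sum_{j\in J}\mathbf a_j\notin\sigma_\beta^\circ$. $\mathbb ZA$ is the subgroup of $\mathbb Z^n$ generated by $A$, $\mathcal M_\beta=(-\sigma_\beta^\circ)\cap\mathbb ZA$, and $E_\beta=\{l\in\mathbb N^N: l_j=0\text{ whenever }\mathbf a_j\notin\sigma_\beta\}$. For $u\in\mathcal M_\beta$, $F_u(\Lambda)$ is the formal Laurent series in $\Lambda_1,\dots,\Lambda_N$ \[F_u(\Lambda)=\sum_{\substack{l\in E_\beta\\ \sum_{j=1}^M(-l_j-1)\mathbf a_j+\sum_{j=M+1}^N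 l_j\mathbf a_j=u}}(-1)^{\sum_{j=1}^M l_j}\frac{\prod_{j=1}^M l_j!}{\prod_{j=M+1}^N l_j!}\,\Lambda_1^{ -l_1-1}\cdots\Lambda_M^{ -l_M-1}\Lambda_{M+1}^{l_{M+1}}\cdots\Lambda_N^{l_N};\] "integral coefficients" means all coefficients lie in $\mathbb Z$. -}

module Defs where

open import Data.Nat as ℕ using (ℕ; zero; suc; _!; NonZero)
open import Data.Nat.Properties using (_!≢0; m*n≢0)
open import Data.Integer as ℤ using (ℤ; +_; -[1+_])
open import Data.Fin using (Fin; zero; suc; toℕ)
open import Data.Fin.Subset using (Subset)
open import Data.Vec using (lookup)
open import Data.Bool using (Bool; true; false; if_then_else_)
open import Data.Rational as ℚ using (ℚ; 0ℚ)
open import Data.Product using (Σ; _×_; _,_)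
open import Relation.Binary.PropositionalEquality using (_≡_; _≢_)
open import Relation.Nullary using (¬_)

Vecℤ : ℕ → Set
Vecℤ n = Fin n → ℤ

∑ : ∀ {m} → (Fin m → ℤ) → ℤ
∑ {zero}  f = + 0
∑ {suc m} f = f zero ℤ.+ ∑ (λ i → f (suc i))

∏ : ∀ {m} → (Fin m → ℕ) → ℕ
∏ {zero}  f = 1
∏ {suc m} f = f zero ℕ.* ∏ (λ i → f (suc i))

∑ℕ : ∀ {m} → (Fin m → ℕ) → ℕ
∑ℕ {zero}  f = 0
∑ℕ {suc m} f = f zero ℕ.+ ∑ℕ (λ i → f (suc i))

∏!≢0 : ∀ {m} (f : Fin m → ℕ) → NonZero (∏ (λ j → f j !))
∏!≢0 {zero}  f = _
∏!≢0 {suc m} f = m*n≢0 (f zero !) (∏ (λ i → f (suc i) !)) {{f zero !≢0}} {{∏!≢0 (λ i → f (suc i))}}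

lin : ∀ {n N} → (Fin N → ℤ) → (Fin N → Vecℤ n) → Vecℤ n
lin c A i = ∑ (λ j → c j ℤ.* A j i)

dot : ∀ {n} → Vecℤ n → Vecℤ n → ℤ
dot w x = ∑ (λ i → w i ℤ.* x i)

-- j ∈ {1,…,M}  (0-based: toℕ j < M)
isPrimed : ∀ {N} → ℕ → Fin N → Bool
isPrimed M j = toℕ j ℕ.<ᵇ M

module Setup {n N : ℕ} (A : Fin N → Vecℤ n) (M : ℕ) where

  -- x ∈ C(A) for an integral point x: k x = ∑ λ_j a_j with k ≥ 1, λ_j ∈ ℕ
  -- (i.e. x is a nonnegative rational combination of the a_j)
  InCone : Vecℤ n → Set
  InCone x = Σ ℕ λ k → Σ (Fin N → ℕ) λ c →
               ∀ i → + (suc k) ℤ.* x i ≡ lin (λ j → + c j) A i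

  Dual : Vecℤ n → Set
  Dual w = ∀ j → + 0 ℤ.≤ dot w (A j)

  -- the closed face C(A) ∩ w^⊥ cut out by a dual functional w
  InFace : Vecℤ n → Vecℤ n → Set
  InFace w x = InCone x × dot w x ≡ + 0

  β : Vecℤ n
  β = lin (λ j → if isPrimed M j then + 1 else + 0) A

  -- σ_β : the smallest face containing β (intersection of all faces containing β)
  InSigma : Vecℤ n → Set
  InSigma x = InCone x × (∀ w → Dual w → InFace w β → InFace w x)

  -- σ_β° : σ_β minus all its proper closed subfaces
  -- (the faces of σ_β are the faces of C(A) contained in σ_β)
  InSigmaInt : Vecℤ n → Set
  InSigmaInt x = InSigma x ×
    (∀ w → Dual w
         → (∀ y → InFace w y → InSigma y)
         → ¬ (∀ y → InSigma y → InFace w y)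
         → ¬ InFace w x)

  -- A' = {a_1..a_M} minimal for σ_β°: for every proper subset J of {1..M},
  -- ∑_{j∈J} a_j ∉ σ_β°
  MinimalFor : Set
  MinimalFor = (J : Subset N)
             → (∀ j → lookup J j ≡ true → isPrimed M j ≡ true)
             → Σ (Fin N) (λ j → isPrimed M j ≡ true × lookup J j ≡ false)
             → ¬ InSigmaInt (lin (λ j → if lookup J j then + 1 else + 0) A)

  InZA : Vecℤ n → Set
  InZA u = Σ (Fin N → ℤ) λ c → ∀ i → u i ≡ lin c A i

  InMβ : Vecℤ n → Set
  InMβ u = InZA u × InSigmaInt (λ i → ℤ.- u i)

  InE : (Fin N → ℕ) → Set
  InE l = ∀ j → ¬ InSigma (A j) → l j ≡ 0

  -- the exponent of Λ_j in the monomial indexed by l: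
  -- -l_j-1 for j ≤ M, l_j for j > M  (also the coefficient of a_j in the constraint)
  expo : (Fin N → ℕ) → Fin N → ℤ
  expo l j = if isPrimed M j then -[1+ l j ] else + l j

  -- l indexes a term of F_u
  Index : Vecℤ n → (Fin N → ℕ) → Set
  Index u l = InE l × (∀ i → lin (expo l) A i ≡ u i)

  numer : (Fin N → ℕ) → ℕ
  numer l = ∏ (λ j → (if isPrimed M j then l j else 0) !)

  denomArg : (Fin N → ℕ) → Fin N → ℕ
  denomArg l j = if isPrimed M j then 0 else l j

  coeff : (Fin N → ℕ) → ℚ
  coeff l = ((ℤ.- (+ 1)) ℤ.^ ∑ℕ (λ j → if isPrimed M j then l j else 0) ℤ.* + numer l)
            ℚ./ ∏ (λ j → denomArg l j !)
            where instance _ = ∏!≢0 (denomArg l)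

  -- F_u(Λ) ≠ 0 : some monomial has a nonzero coefficient
  -- (distinct l give distinct monomials Λ^{expo l})
  FNonzero : Vecℤ n → Set
  FNonzero u = Σ (Fin N → ℕ) λ l → Index u l × coeff l ≢ 0ℚ

  IntegralCoeffs : Vecℤ n → Set
  IntegralCoeffs u = ∀ l → Index u l → Σ ℤ λ z → coeff l ≡ z ℚ./ 1

{-# OPTIONS --safe #-}
module Submission where

-- The coefficient of F_u at an index l is ± ∏_{j≤M} l_j! / ∏_{j>M} l_j!. Reading off the last
-- coordinate, −u_n = M + ∑_{j≤M} l_j − ∑_{j>M} l_j, so the hypothesis on M says that the denominator
-- arguments never sum to more than the numerator arguments. For a prime p, ⌊l/p⌋ is again an index
-- of some F_{u′} with u′ ∈ 𝓜_β: p·(−u′) differs from −u by a nonnegative combination of generators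
-- lying in σ_β, so −u′ stays in the relative interior. Iterating, ∑_j ⌊l_j/p^k⌋ over the denominator
-- never exceeds the same sum over the numerator, and Legendre's formula gives divisibility at p.

open import Defs
open import Data.Nat using (ℕ; NonZero)
open import Data.Nat.DivMod using (_/_)
open import Data.Fin using (Fin)

⌊_/_⌋ : ∀ {N} → (Fin N → ℕ) → (p : ℕ) .{{_ : NonZero p}} → Fin N → ℕ
⌊ a / p ⌋ j = a j / p

module Sums where

  open import Data.Nat as ℕ using (zero; suc; _!)
  import Data.Nat.Properties as ℕ
  open import Data.Integer using (ℤ; +_; _+_; _*_; -_; _≤_; +≤+)
  import Data.Integer.Properties as ℤ
  open import Data.Fin using (Fin; zero; suc)
  open import Data.Bool using (if_then_else_)
  open import Data.Product using (_×_; _,_)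
  open import Relation.Binary.PropositionalEquality
  open import Algebra.Properties.CommutativeSemigroup ℤ.+-commutativeSemigroup using (interchange)

  ∑-cong : ∀ {m} {f g : Fin m → ℤ} → f ≗ g → ∑ f ≡ ∑ g
  ∑-cong {zero}  f≗g = refl
  ∑-cong {suc m} f≗g = cong₂ _+_ (f≗g zero) (∑-cong (λ j → f≗g (suc j)))

  ∑-zero : ∀ m → ∑ {m} (λ _ → + 0) ≡ + 0
  ∑-zero zero    = refl
  ∑-zero (suc m) = trans (ℤ.+-identityˡ _) (∑-zero m)

  ∑-distrib-+ : ∀ {m} (f g : Fin m → ℤ) → ∑ (λ j → f j + g j) ≡ ∑ f + ∑ g
  ∑-distrib-+ {zero}  f g = refl
  ∑-distrib-+ {suc m} f g =
    trans (cong (_+_ (f zero + g zero)) (∑-distrib-+ (λ j → f (suc j)) (λ j → g (suc j))))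
          (interchange (f zero) (g zero) _ _)

  *-distribˡ-∑ : ∀ {m} c (f : Fin m → ℤ) → c * ∑ f ≡ ∑ (λ j → c * f j)
  *-distribˡ-∑ {zero}  c f = ℤ.*-zeroʳ c
  *-distribˡ-∑ {suc m} c f =
    trans (ℤ.*-distribˡ-+ c (f zero) _) (cong (_+_ (c * f zero)) (*-distribˡ-∑ c (λ j → f (suc j))))

  neg-distrib-∑ : ∀ {m} (f : Fin m → ℤ) → - ∑ f ≡ ∑ (λ j → - f j)
  neg-distrib-∑ {zero}  f = refl
  neg-distrib-∑ {suc m} f =
    trans (ℤ.neg-distrib-+ (f zero) _) (cong (_+_ (- f zero)) (neg-distrib-∑ (λ j → f (suc j))))

  ∑-comm : ∀ {m k} (f : Fin m → Fin k → ℤ) → ∑ (λ i → ∑ (f i)) ≡ ∑ (λ j → ∑ (λ i → f i j))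
  ∑-comm {zero}  {k} f = sym (∑-zero k)
  ∑-comm {suc m} f =
    trans (cong (_+_ (∑ (f zero))) (∑-comm (λ i → f (suc i))))
          (sym (∑-distrib-+ (f zero) (λ j → ∑ (λ i → f (suc i) j))))

  pos-∑ℕ : ∀ {m} (f : Fin m → ℕ) → + ∑ℕ f ≡ ∑ (λ j → + f j)
  pos-∑ℕ {zero}  f = refl
  pos-∑ℕ {suc m} f = trans (ℤ.pos-+ (f zero) _) (cong (_+_ (+ f zero)) (pos-∑ℕ (λ j → f (suc j))))

  ∑-nonneg : ∀ {m} {f : Fin m → ℤ} → (∀ j → + 0 ≤ f j) → + 0 ≤ ∑ f
  ∑-nonneg {zero}  f≥0 = +≤+ ℕ.z≤n
  ∑-nonneg {suc m} f≥0 = ℤ.+-mono-≤ (f≥0 zero) (∑-nonneg (λ j → f≥0 (suc j)))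

  nonneg-+≡0⇒ : ∀ {a b : ℤ} → + 0 ≤ a → + 0 ≤ b → a + b ≡ + 0 → a ≡ + 0 × b ≡ + 0
  nonneg-+≡0⇒ {+ a} {+ b} _ _ a+b≡0 =
    cong +_ (ℕ.m+n≡0⇒m≡0 a (ℤ.+-injective a+b≡0)) , cong +_ (ℕ.m+n≡0⇒n≡0 a (ℤ.+-injective a+b≡0))

  ∑-nonneg≡0⇒≡0 : ∀ {m} {f : Fin m → ℤ} → (∀ j → + 0 ≤ f j) → ∑ f ≡ + 0 → ∀ j → f j ≡ + 0
  ∑-nonneg≡0⇒≡0 {suc m} f≥0 ∑f≡0 j with nonneg-+≡0⇒ (f≥0 zero) (∑-nonneg (λ j → f≥0 (suc j))) ∑f≡0
  ∑-nonneg≡0⇒≡0 {suc m} f≥0 ∑f≡0 zero    | f₀≡0 , _      = f₀≡0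
  ∑-nonneg≡0⇒≡0 {suc m} f≥0 ∑f≡0 (suc j) | _    , rest≡0 = ∑-nonneg≡0⇒≡0 (λ j → f≥0 (suc j)) rest≡0 j

  ∑ℕ-cong : ∀ {m} {f g : Fin m → ℕ} → f ≗ g → ∑ℕ f ≡ ∑ℕ g
  ∑ℕ-cong {zero}  f≗g = refl
  ∑ℕ-cong {suc m} f≗g = cong₂ ℕ._+_ (f≗g zero) (∑ℕ-cong (λ j → f≗g (suc j)))

  ∑ℕ≡0⇒∏!≡1 : ∀ {m} (f : Fin m → ℕ) → ∑ℕ f ≡ 0 → ∏ (λ j → f j !) ≡ 1
  ∑ℕ≡0⇒∏!≡1 {zero}  f _ = refl
  ∑ℕ≡0⇒∏!≡1 {suc m} f ∑f≡0 rewrite ℕ.m+n≡0⇒m≡0 (f zero) ∑f≡0 =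
    trans (ℕ.+-identityʳ _) (∑ℕ≡0⇒∏!≡1 (λ j → f (suc j)) (ℕ.m+n≡0⇒n≡0 (f zero) ∑f≡0))

  #primed≡M : ∀ {N} M → M ℕ.≤ N → ∑ℕ {N} (λ j → if isPrimed M j then 1 else 0) ≡ M
  #primed≡M {N}     zero    _ = #primed≡0 N
    where
    #primed≡0 : ∀ N → ∑ℕ {N} (λ j → if isPrimed 0 j then 1 else 0) ≡ 0
    #primed≡0 zero    = refl
    #primed≡0 (suc N) = #primed≡0 N
  #primed≡M {suc N} (suc M) (ℕ.s≤s M≤N) = cong suc (#primed≡M M M≤N)

module LinearCombinations where

  open import Data.Integer using (ℤ; _+_; _*_; -_)
  import Data.Integer.Properties as ℤ
  open import Relation.Binary.PropositionalEquality
  open import Algebra.Properties.CommutativeSemigroup ℤ.*-commutativeSemigroup using (x∙yz≈y∙xz)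
  open Sums

  module _ {n N : ℕ} (A : Fin N → Vecℤ n) where

    lin-cong : ∀ {e f : Fin N → ℤ} → e ≗ f → lin e A ≗ lin f A
    lin-cong e≗f i = ∑-cong (λ j → cong (_* A j i) (e≗f j))

    lin-+ : ∀ (e f : Fin N → ℤ) → lin (λ j → e j + f j) A ≗ (λ i → lin e A i + lin f A i)
    lin-+ e f i = trans (∑-cong (λ j → ℤ.*-distribʳ-+ (A j i) (e j) (f j)))
                        (∑-distrib-+ (λ j → e j * A j i) (λ j → f j * A j i))

    *-lin : ∀ (k : ℤ) (e : Fin N → ℤ) → (λ i → k * lin e A i) ≗ lin (λ j → k * e j) A
    *-lin k e i = trans (*-distribˡ-∑ k (λ j → e j * A j i)) (∑-cong (λ j → sym (ℤ.*-assoc k (e j) (A j i))))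

    lin-combine : ∀ (a b : ℤ) (e f : Fin N → ℤ)
                → (λ i → a * lin e A i + b * lin f A i) ≗ lin (λ j → a * e j + b * f j) A
    lin-combine a b e f i =
      trans (cong₂ _+_ (*-lin a e i) (*-lin b f i)) (sym (lin-+ (λ j → a * e j) (λ j → b * f j) i))

    neg-lin : ∀ (e : Fin N → ℤ) → (λ i → - lin e A i) ≗ lin (λ j → - e j) A
    neg-lin e i = trans (neg-distrib-∑ (λ j → e j * A j i)) (∑-cong (λ j → ℤ.neg-distribˡ-* (e j) (A j i)))

    dot-lin : ∀ (w : Vecℤ n) (c : Fin N → ℤ) → dot w (lin c A) ≡ ∑ (λ j → c j * dot w (A j))
    dot-lin w c = begin
      ∑ (λ i → w i * ∑ (λ j → c j * A j i))     ≡⟨ ∑-cong (λ i → *-distribˡ-∑ (w i) (λ j → c j * A j i)) ⟩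
      ∑ (λ i → ∑ (λ j → w i * (c j * A j i)))   ≡⟨ ∑-comm (λ i j → w i * (c j * A j i)) ⟩
      ∑ (λ j → ∑ (λ i → w i * (c j * A j i)))   ≡⟨ ∑-cong (λ j → ∑-cong (λ i → x∙yz≈y∙xz (w i) (c j) (A j i))) ⟩
      ∑ (λ j → ∑ (λ i → c j * (w i * A j i)))   ≡⟨ ∑-cong (λ j → sym (*-distribˡ-∑ (c j) (λ i → w i * A j i))) ⟩
      ∑ (λ j → c j * dot w (A j))               ∎
      where open ≡-Reasoning

  module _ {n : ℕ} (w : Vecℤ n) where

    dot-cong : ∀ {x y : Vecℤ n} → x ≗ y → dot w x ≡ dot w y
    dot-cong x≗y = ∑-cong (λ i → cong (w i *_) (x≗y i))

    dot-+ : ∀ (x y : Vecℤ n) → dot w (λ i → x i + y i) ≡ dot w x + dot w y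
    dot-+ x y = trans (∑-cong (λ i → ℤ.*-distribˡ-+ (w i) (x i) (y i)))
                      (∑-distrib-+ (λ i → w i * x i) (λ i → w i * y i))

    dot-* : ∀ (k : ℤ) (x : Vecℤ n) → dot w (λ i → k * x i) ≡ k * dot w x
    dot-* k x = trans (∑-cong (λ i → x∙yz≈y∙xz (w i) k (x i))) (sym (*-distribˡ-∑ k (λ i → w i * x i)))

module FactorialQuotients where

  open import Data.Nat
  open import Data.Nat.Properties
  open import Data.Nat.Divisibility
  open import Data.Nat.DivMod using (_%_; m≡m%n+[m/n]*n; m%n<n)
  open import Data.Nat.Primality using (Prime; prime⇒nonZero; prime⇒nonTrivial; prime⇒irreducible; euclidsLemma)
  open import Data.Nat.Primality.Factorisation using (factorise; module PrimeFactorisation)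
  open import Data.Nat.Induction using (<-rec)
  open import Data.Nat.ListAction using (product)
  open import Data.Nat.Solver using (module +-*-Solver)
  open import Data.Fin using (zero; suc)
  open import Data.List using ([]; _∷_)
  open import Data.List.Relation.Unary.All using (All; []; _∷_)
  open import Data.Product using (∃; _×_; _,_)
  open import Data.Sum using (inj₁; inj₂)
  open import Function using (_∘_)
  open import Relation.Binary.PropositionalEquality
  open import Relation.Nullary using (¬_; yes; no; contradiction)
  open Sums using (∑ℕ≡0⇒∏!≡1)

  open +-*-Solver

  ∏! : ∀ {N} → (Fin N → ℕ) → ℕ
  ∏! a = ∏ (λ j → a j !)

  ^-monoʳ-∣ : ∀ x {m n} → m ≤ n → x ^ m ∣ x ^ n
  ^-monoʳ-∣ x {m} {n} m≤n = divides (x ^ (n ∸ m)) (begin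
    x ^ n                 ≡⟨ cong (x ^_) (m+[n∸m]≡n m≤n) ⟨
    x ^ (m + (n ∸ m))     ≡⟨ ^-distribˡ-+-* x m (n ∸ m) ⟩
    x ^ m * x ^ (n ∸ m)   ≡⟨ *-comm (x ^ m) _ ⟩
    x ^ (n ∸ m) * x ^ m   ∎)
    where open ≡-Reasoning

  module _ {p : ℕ} (p-prime : Prime p) where

    instance
      p≢0 : NonZero p
      p≢0 = prime⇒nonZero p-prime

    p∤1 : ¬ p ∣ 1
    p∤1 p∣1 = nonTrivial⇒≢1 {{prime⇒nonTrivial p-prime}} (∣1⇒≡1 p∣1)

    p∤*p∤⇒p∤* : ∀ {m n} → ¬ p ∣ m → ¬ p ∣ n → ¬ p ∣ m * n
    p∤*p∤⇒p∤* {m} {n} p∤m p∤n p∣mn with euclidsLemma m n p-prime p∣mn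
    ... | inj₁ p∣m = p∤m p∣m
    ... | inj₂ p∣n = p∤n p∣n

    p^e∣1⇒e≡0 : ∀ e → p ^ e ∣ 1 → e ≡ 0
    p^e∣1⇒e≡0 zero    _      = refl
    p^e∣1⇒e≡0 (suc e) p^e∣1 = contradiction (∣-trans (m∣m*n (p ^ e)) p^e∣1) p∤1

    p^e∣m*r⇒p^e∣m : ∀ e {m r} → ¬ p ∣ r → p ^ e ∣ m * r → p ^ e ∣ m
    p^e∣m*r⇒p^e∣m zero    {m}     _   _ = 1∣ m
    p^e∣m*r⇒p^e∣m (suc e) {m} {r} p∤r p^[1+e]∣mr
      with euclidsLemma m r p-prime (∣-trans (m∣m*n (p ^ e)) p^[1+e]∣mr)
    ... | inj₂ p∣r = contradiction p∣r p∤r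
    ... | inj₁ (divides m′ refl) =
      subst (p * p ^ e ∣_) (*-comm p m′) (*-monoʳ-∣ p (p^e∣m*r⇒p^e∣m e p∤r (*-cancelˡ-∣ p p∣pm′r)))
      where
      p∣pm′r : p * p ^ e ∣ p * (m′ * r)
      p∣pm′r = subst (p * p ^ e ∣_) (solve 3 (λ a b c → (a :* b) :* c := b :* (a :* c)) refl m′ p r) p^[1+e]∣mr

    p∤[1+r+q*p] : ∀ q r → suc r < p → ¬ p ∣ suc r + q * p
    p∤[1+r+q*p] q r 1+r<p p∣ =
      <⇒≱ 1+r<p (∣⇒≤ (∣m+n∣m⇒∣n (subst (p ∣_) (+-comm (suc r) (q * p)) p∣) (n∣m*n q)))

    -- The multiples of p up to r + q p are p, 2p, …, q p, with product p^q q!.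
    factorial-split′ : ∀ q r → r < p → ∃ λ R → ¬ p ∣ R × (r + q * p) ! ≡ p ^ q * q ! * R
    factorial-split′ zero    zero    _ = 1 , p∤1 , refl
    factorial-split′ (suc q) zero    _ with factorial-split′ q (pred p) (m≤pred[n]⇒suc[m]≤n ≤-refl)
    ... | R , p∤R , eq = R , p∤R , (begin
      (p + q * p) !                          ≡⟨ cong _! 1+[p-1+qp]≡p+qp ⟨
      suc (pred p + q * p) !                 ≡⟨ cong (suc (pred p + q * p) *_) eq ⟩
      suc (pred p + q * p) * (p ^ q * q ! * R) ≡⟨ cong (_* (p ^ q * q ! * R)) 1+[p-1+qp]≡p+qp ⟩
      (p + q * p) * (p ^ q * q ! * R)        ≡⟨ solve 5 (λ p q x y R → (p :+ q :* p) :* (x :* y :* R)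
                                                           := p :* x :* (y :+ q :* y) :* R) refl p q (p ^ q) (q !) R ⟩
      p ^ suc q * suc q ! * R                ∎)
      where
      open ≡-Reasoning
      1+[p-1+qp]≡p+qp : suc (pred p + q * p) ≡ p + q * p
      1+[p-1+qp]≡p+qp = cong (_+ q * p) (suc-pred p)
    factorial-split′ q (suc r) 1+r<p with factorial-split′ q r (<-trans (n<1+n r) 1+r<p)
    ... | R , p∤R , eq = suc (r + q * p) * R , p∤*p∤⇒p∤* (p∤[1+r+q*p] q r 1+r<p) p∤R , (begin
      suc (r + q * p) * (r + q * p) !        ≡⟨ cong (suc (r + q * p) *_) eq ⟩
      suc (r + q * p) * (p ^ q * q ! * R)    ≡⟨ solve 4 (λ a b c e → a :* (b :* c :* e) := b :* c :* (a :* e))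
                                                       refl (suc (r + q * p)) (p ^ q) (q !) R ⟩
      p ^ q * q ! * (suc (r + q * p) * R)    ∎)
      where open ≡-Reasoning

    factorial-split : ∀ n → ∃ λ R → ¬ p ∣ R × n ! ≡ p ^ (n / p) * (n / p) ! * R
    factorial-split n with factorial-split′ (n / p) (n % p) (m%n<n n p)
    ... | R , p∤R , eq = R , p∤R , trans (cong _! (m≡m%n+[m/n]*n n p)) eq

    ∏!-split : ∀ {N} (a : Fin N → ℕ) → ∃ λ R → ¬ p ∣ R × ∏! a ≡ p ^ ∑ℕ ⌊ a / p ⌋ * ∏! ⌊ a / p ⌋ * R
    ∏!-split {zero}  a = 1 , p∤1 , refl
    ∏!-split {suc N} a with factorial-split (a zero) | ∏!-split (λ j → a (suc j))
    ... | R₀ , p∤R₀ , eq₀ | R , p∤R , eq = R₀ * R , p∤*p∤⇒p∤* p∤R₀ p∤R , (begin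
      a zero ! * ∏! (λ j → a (suc j))          ≡⟨ cong₂ _*_ eq₀ eq ⟩
      (p ^ x * y * R₀) * (p ^ X * Y * R)       ≡⟨ solve 6 (λ a b c d e f → (a :* b :* c) :* (d :* e :* f)
                                                           := (a :* d) :* (b :* e) :* (c :* f)) refl (p ^ x) y R₀ (p ^ X) Y R ⟩
      (p ^ x * p ^ X) * (y * Y) * (R₀ * R)     ≡⟨ cong (λ t → t * (y * Y) * (R₀ * R)) (^-distribˡ-+-* p x X) ⟨
      p ^ (x + X) * (y * Y) * (R₀ * R)         ∎)
      where
      open ≡-Reasoning
      x X y Y : ℕ
      x = a zero / p
      X = ∑ℕ (λ j → a (suc j) / p)
      y = (a zero / p) !
      Y = ∏! (λ j → a (suc j) / p)

    p^e∣∏!⇒ : ∀ {N} e (a : Fin N → ℕ) → p ^ e ∣ ∏! a → p ^ e ∣ p ^ ∑ℕ ⌊ a / p ⌋ * ∏! ⌊ a / p ⌋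
    p^e∣∏!⇒ e a p^e∣∏!a with ∏!-split a
    ... | R , p∤R , eq = p^e∣m*r⇒p^e∣m e p∤R (subst (p ^ e ∣_) eq p^e∣∏!a)

    ⇒p^e∣∏! : ∀ {N} e (a : Fin N → ℕ) → p ^ e ∣ p ^ ∑ℕ ⌊ a / p ⌋ * ∏! ⌊ a / p ⌋ → p ^ e ∣ ∏! a
    ⇒p^e∣∏! e a p^e∣ with ∏!-split a
    ... | R , _ , eq = subst (p ^ e ∣_) (sym eq) (∣m⇒∣m*n R p^e∣)

    module _ {N} (G : (Fin N → ℕ) → (Fin N → ℕ) → Set)
             (G-floor : ∀ {a b} → G a b → G ⌊ a / p ⌋ ⌊ b / p ⌋)
             (G-∑≤ : ∀ {a b} → G a b → ∑ℕ b ≤ ∑ℕ a) where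

      -- As ∑⌊b/p⌋ ≤ ∑⌊a/p⌋, peeling p^(∑⌊b/p⌋) off both sides leaves the same question for ⌊b/p⌋, ⌊a/p⌋
      -- and a smaller exponent.
      p^e∣∏!-transfer : ∀ e {a b} → G a b → p ^ e ∣ ∏! b → p ^ e ∣ ∏! a
      p^e∣∏!-transfer = <-rec _ step
        where
        step : ∀ e → (∀ {e′} → e′ < e → ∀ {a b} → G a b → p ^ e′ ∣ ∏! b → p ^ e′ ∣ ∏! a)
             → ∀ {a b} → G a b → p ^ e ∣ ∏! b → p ^ e ∣ ∏! a
        step e rec {a} {b} g p^e∣∏!b with e ≤? ∑ℕ ⌊ b / p ⌋
        ... | yes e≤B = ⇒p^e∣∏! e a (∣m⇒∣m*n _ (^-monoʳ-∣ p (≤-trans e≤B (G-∑≤ (G-floor g)))))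
        ... | no  e≰B = ⇒p^e∣∏! e a (subst (_∣ p ^ ∑ℕ ⌊ a / p ⌋ * ∏! ⌊ a / p ⌋) (sym p^e≡p^B*p^e′)
                          (*-pres-∣ (^-monoʳ-∣ p (G-∑≤ (G-floor g))) (rec e′<e (G-floor g) p^e′∣∏!⌊b/p⌋)))
          where
          open ≡-Reasoning
          B e′ : ℕ
          B = ∑ℕ ⌊ b / p ⌋
          e′ = e ∸ B
          B+e′≡e : B + e′ ≡ e
          B+e′≡e = m+[n∸m]≡n (<⇒≤ (≰⇒> e≰B))
          p^e≡p^B*p^e′ : p ^ e ≡ p ^ B * p ^ e′
          p^e≡p^B*p^e′ = trans (cong (p ^_) (sym B+e′≡e)) (^-distribˡ-+-* p B e′)
          p^e′∣∏!⌊b/p⌋ : p ^ e′ ∣ ∏! ⌊ b / p ⌋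
          p^e′∣∏!⌊b/p⌋ = *-cancelˡ-∣ (p ^ B) {{m^n≢0 p B}}
            (subst (_∣ p ^ B * ∏! ⌊ b / p ⌋) p^e≡p^B*p^e′ (p^e∣∏!⇒ e b p^e∣∏!b))
          B≢0 : B ≢ 0
          B≢0 B≡0 = e≰B (≤-reflexive (begin
            e       ≡⟨ B+e′≡e ⟨
            B + e′  ≡⟨ cong (B +_) (p^e∣1⇒e≡0 e′ (subst (p ^ e′ ∣_) (∑ℕ≡0⇒∏!≡1 ⌊ b / p ⌋ B≡0) p^e′∣∏!⌊b/p⌋)) ⟩
            B + 0   ≡⟨ +-identityʳ B ⟩
            B       ∎))
          e′<e : e′ < e
          e′<e = subst (e′ <_) B+e′≡e (m<n+m e′ (n≢0⇒n>0 B≢0))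

  p∤q : ∀ {p q} → Prime p → Prime q → p ≢ q → ¬ p ∣ q
  p∤q p-prime q-prime p≢q p∣q with prime⇒irreducible q-prime p∣q
  ... | inj₁ p≡1 = nonTrivial⇒≢1 {{prime⇒nonTrivial p-prime}} p≡1
  ... | inj₂ p≡q = p≢q p≡q

  product-∣ : ∀ {qs} n → All Prime qs → (∀ {p} e → Prime p → p ^ e ∣ product qs → p ^ e ∣ n) → product qs ∣ n
  product-∣ {[]}     n _                    _     = 1∣ n
  product-∣ {q ∷ qs} n (q-prime ∷ qs-prime) p^e∣ with p^e∣ 1 q-prime (*-monoʳ-∣ q (1∣ product qs))
  ... | divides n′ eq = subst (q * product qs ∣_) (sym (trans eq′ (*-comm n′ q)))
                          (*-monoʳ-∣ q (product-∣ n′ qs-prime p^e∣n′))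
    where
    instance
      q≢0 : NonZero q
      q≢0 = prime⇒nonZero q-prime
    eq′ : n ≡ n′ * q
    eq′ = trans eq (cong (n′ *_) (*-identityʳ q))
    p^e∣n′ : ∀ {p} e → Prime p → p ^ e ∣ product qs → p ^ e ∣ n′
    p^e∣n′ {p} e p-prime p^e∣qs with p ≟ q
    ... | yes refl = *-cancelˡ-∣ p (subst (p * p ^ e ∣_) (trans eq′ (*-comm n′ p))
                                      (p^e∣ (suc e) p-prime (*-monoʳ-∣ p p^e∣qs)))
    ... | no  p≢q  = p^e∣m*r⇒p^e∣m p-prime e (p∤q p-prime q-prime p≢q)
                       (subst (p ^ e ∣_) eq′ (p^e∣ e p-prime (∣n⇒∣m*n q p^e∣qs)))

  ∣-by-prime-powers : ∀ m n .{{_ : NonZero m}} → (∀ {p} e → Prime p → p ^ e ∣ m → p ^ e ∣ n) → m ∣ n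
  ∣-by-prime-powers m n p^e∣ =
    subst (_∣ n) m≡∏qs (product-∣ n factorsPrime (λ e p-prime → p^e∣ e p-prime ∘ subst (_ ∣_) m≡∏qs))
    where
    open PrimeFactorisation (factorise m)
    m≡∏qs : product factors ≡ m
    m≡∏qs = sym isFactorisation

  -- A form of Landau's criterion for the integrality of factorial ratios.
  ∏!∣∏! : ∀ {N} (G : (Fin N → ℕ) → (Fin N → ℕ) → Set)
        → (∀ {p} (p-prime : Prime p) {a b} → G a b
             → G (⌊ a / p ⌋ {{prime⇒nonZero p-prime}}) (⌊ b / p ⌋ {{prime⇒nonZero p-prime}}))
        → (∀ {a b} → G a b → ∑ℕ b ≤ ∑ℕ a)
        → ∀ {a b} → G a b → ∏! b ∣ ∏! a
  ∏!∣∏! G G-floor G-∑≤ {a} {b} g = ∣-by-prime-powers (∏! b) (∏! a) {{∏!≢0 b}}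
    (λ e p-prime → p^e∣∏!-transfer p-prime G (G-floor p-prime) G-∑≤ e g)

module Faces {n N : ℕ} (A : Fin N → Vecℤ n) (M : ℕ) where

  open import Data.Nat as ℕ using (suc)
  open import Data.Integer using (ℤ; +_; _+_; _*_; -_; _≤_; +≤+; _≟_)
  import Data.Integer.Properties as ℤ
  open import Data.Integer.Solver using (module +-*-Solver)
  open import Data.Bool using (true; false; if_then_else_)
  open import Data.Product using (_×_; _,_; proj₁; proj₂)
  open import Data.Sum using (_⊎_; inj₁; inj₂)
  open import Relation.Binary.PropositionalEquality
  open import Relation.Nullary using (¬_; yes; no)
  open Setup A M
  open Sums
  open LinearCombinations

  open +-*-Solver

  0≤[1+k]*i⇒0≤i : ∀ k {i} → + 0 ≤ + suc k * i → + 0 ≤ i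
  0≤[1+k]*i⇒0≤i k {i} 0≤ki =
    ℤ.*-cancelˡ-≤-pos (+ 0) i (+ suc k) (subst (_≤ + suc k * i) (sym (ℤ.*-zeroʳ (+ suc k))) 0≤ki)

  [1+k]*i≡0⇒i≡0 : ∀ k {i} → + suc k * i ≡ + 0 → i ≡ + 0
  [1+k]*i≡0⇒i≡0 k {i} ki≡0 = ℤ.*-cancelˡ-≡ (+ suc k) i (+ 0) (trans ki≡0 (sym (ℤ.*-zeroʳ (+ suc k))))

  Dual⇒0≤dot : ∀ w v → Dual w → InCone v → + 0 ≤ dot w v
  Dual⇒0≤dot w v dual-w (k , d , kv≡) = 0≤[1+k]*i⇒0≤i k (subst (+ 0 ≤_) ∑≡kdot (∑-nonneg 0≤terms))
    where
    0≤terms : ∀ j → + 0 ≤ + d j * dot w (A j)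
    0≤terms j = subst (_≤ + d j * dot w (A j)) (ℤ.*-zeroʳ (+ d j)) (ℤ.*-monoˡ-≤-nonNeg (+ d j) (dual-w j))
    ∑≡kdot : ∑ (λ j → + d j * dot w (A j)) ≡ + suc k * dot w v
    ∑≡kdot = trans (sym (dot-lin A w (λ j → + d j))) (trans (dot-cong w (λ i → sym (kv≡ i))) (dot-* w (+ suc k) v))

  InCone-divide : ∀ m {x z y : Vecℤ n} → InCone x → InCone z → (∀ i → + suc m * y i ≡ x i + z i) → InCone y
  InCone-divide m {x} {z} {y} (k , d , kx≡) (k′ , d′ , k′z≡) my≡ =
    ℕ.pred (suc k ℕ.* suc k′ ℕ.* suc m) , (λ j → suc k′ ℕ.* d j ℕ.+ suc k ℕ.* d′ j) , λ i → begin
      + (suc k ℕ.* suc k′ ℕ.* suc m) * y i         ≡⟨ cong (_* y i) pos-*³ ⟩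
      K * K′ * P * y i                              ≡⟨ ℤ.*-assoc (K * K′) P (y i) ⟩
      K * K′ * (P * y i)                            ≡⟨ cong (K * K′ *_) (my≡ i) ⟩
      K * K′ * (x i + z i)                          ≡⟨ distribute K K′ (x i) (z i) ⟩
      K′ * (K * x i) + K * (K′ * z i)               ≡⟨ cong₂ (λ s t → K′ * s + K * t) (kx≡ i) (k′z≡ i) ⟩
      K′ * lin D A i + K * lin D′ A i               ≡⟨ lin-combine A K′ K D D′ i ⟩
      lin (λ j → K′ * D j + K * D′ j) A i           ≡⟨ lin-cong A (λ j → sym (pos-combination j)) i ⟩
      lin (λ j → + (suc k′ ℕ.* d j ℕ.+ suc k ℕ.* d′ j)) A i ∎
    where
    open ≡-Reasoning
    K K′ P : ℤ
    K = + suc k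
    K′ = + suc k′
    P = + suc m
    D D′ : Fin N → ℤ
    D j = + d j
    D′ j = + d′ j
    pos-*³ : + (suc k ℕ.* suc k′ ℕ.* suc m) ≡ K * K′ * P
    pos-*³ = trans (ℤ.pos-* (suc k ℕ.* suc k′) (suc m)) (cong (_* P) (ℤ.pos-* (suc k) (suc k′)))
    distribute : ∀ a b x z → a * b * (x + z) ≡ b * (a * x) + a * (b * z)
    distribute = solve 4 (λ a b x z → a :* b :* (x :+ z) := b :* (a :* x) :+ a :* (b :* z)) refl
    pos-combination : ∀ j → + (suc k′ ℕ.* d j ℕ.+ suc k ℕ.* d′ j) ≡ K′ * D j + K * D′ j
    pos-combination j =
      trans (ℤ.pos-+ (suc k′ ℕ.* d j) _) (cong₂ _+_ (ℤ.pos-* (suc k′) (d j)) (ℤ.pos-* (suc k) (d′ j)))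

  InSigmaInt-divide : ∀ m {x z y : Vecℤ n} → InSigmaInt x → InSigma z → (∀ i → + suc m * y i ≡ x i + z i)
                    → InSigmaInt y
  InSigmaInt-divide m {x} {z} {y} ((x-cone , x-faces) , x-interior) (z-cone , z-faces) my≡ =
    (y-cone , y-faces) , y-interior
    where
    y-cone : InCone y
    y-cone = InCone-divide m x-cone z-cone my≡
    dot-y : ∀ w → + suc m * dot w y ≡ dot w x + dot w z
    dot-y w = trans (sym (dot-* w (+ suc m) y)) (trans (dot-cong w my≡) (dot-+ w x z))
    y-faces : ∀ w → Dual w → InFace w β → InFace w y
    y-faces w dual-w β∈face = y-cone , [1+k]*i≡0⇒i≡0 m (trans (dot-y w)
      (cong₂ _+_ (proj₂ (x-faces w dual-w β∈face)) (proj₂ (z-faces w dual-w β∈face))))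
    y-interior : ∀ w → Dual w → (∀ v → InFace w v → InSigma v) → ¬ (∀ v → InSigma v → InFace w v)
               → ¬ InFace w y
    y-interior w dual-w face⊆σ σ⊈face (_ , wy≡0) = x-interior w dual-w face⊆σ σ⊈face (x-cone , wx≡0)
      where
      wx+wz≡0 : dot w x + dot w z ≡ + 0
      wx+wz≡0 = trans (sym (dot-y w)) (trans (cong (+ suc m *_) wy≡0) (ℤ.*-zeroʳ (+ suc m)))
      wx≡0 : dot w x ≡ + 0
      wx≡0 = proj₁ (nonneg-+≡0⇒ (Dual⇒0≤dot w x dual-w x-cone) (Dual⇒0≤dot w z dual-w z-cone) wx+wz≡0)

  primed-on-faces : ∀ w → Dual w → InFace w β → ∀ j → isPrimed M j ≡ true → dot w (A j) ≡ + 0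
  primed-on-faces w dual-w (_ , wβ≡0) j j-primed =
    trans (sym (term≡ j j-primed)) (∑-nonneg≡0⇒≡0 0≤term (trans (sym (dot-lin A w primed)) wβ≡0) j)
    where
    primed : Fin N → ℤ
    primed j = if isPrimed M j then + 1 else + 0
    0≤term : ∀ j → + 0 ≤ primed j * dot w (A j)
    0≤term j with isPrimed M j
    ... | true  = subst (+ 0 ≤_) (sym (ℤ.*-identityˡ _)) (dual-w j)
    ... | false = +≤+ ℕ.z≤n
    term≡ : ∀ j → isPrimed M j ≡ true → primed j * dot w (A j) ≡ dot w (A j)
    term≡ j j-primed rewrite j-primed = ℤ.*-identityˡ _

  lin-InSigma : ∀ (c : Fin N → ℕ) → (∀ j w → Dual w → InFace w β → c j ≡ 0 ⊎ dot w (A j) ≡ + 0)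
              → InSigma (lin (λ j → + c j) A)
  lin-InSigma c c-on-faces = cone , λ w dual-w β∈face → cone , trans (dot-lin A w (λ j → + c j))
    (trans (∑-cong (term≡0 w dual-w β∈face)) (∑-zero N))
    where
    cone : InCone (lin (λ j → + c j) A)
    cone = 0 , c , λ i → ℤ.*-identityˡ _
    term≡0 : ∀ w → Dual w → InFace w β → ∀ j → + c j * dot w (A j) ≡ + 0
    term≡0 w dual-w β∈face j with c-on-faces j w dual-w β∈face
    ... | inj₁ cj≡0  rewrite cj≡0  = refl
    ... | inj₂ waj≡0 rewrite waj≡0 = ℤ.*-zeroʳ (+ c j)

  module _ (m : ℕ) where

    open import Data.Nat.DivMod using (_%_; m≡m%n+[m/n]*n; m%n<n; 0/n≡0)
    import Data.Nat.Properties as ℕ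
    open import Algebra.Properties.CommutativeSemigroup ℕ.+-commutativeSemigroup using (xy∙z≈xz∙y)

    [1+m]*[1+l/[1+m]] : ∀ l → suc m ℕ.* suc (l / suc m) ≡ suc l ℕ.+ (m ℕ.∸ l % suc m)
    [1+m]*[1+l/[1+m]] l = begin
      suc m ℕ.* suc q                        ≡⟨ ℕ.*-comm (suc m) (suc q) ⟩
      suc m ℕ.+ q ℕ.* suc m                  ≡⟨ cong (λ t → suc t ℕ.+ q ℕ.* suc m) (ℕ.m+[n∸m]≡n r≤m) ⟨
      suc (r ℕ.+ (m ℕ.∸ r)) ℕ.+ q ℕ.* suc m  ≡⟨ cong suc (xy∙z≈xz∙y r (m ℕ.∸ r) (q ℕ.* suc m)) ⟩
      suc (r ℕ.+ q ℕ.* suc m) ℕ.+ (m ℕ.∸ r)  ≡⟨ cong (λ t → suc t ℕ.+ (m ℕ.∸ r)) (m≡m%n+[m/n]*n l (suc m)) ⟨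
      suc l ℕ.+ (m ℕ.∸ r)                    ∎
      where
      open ≡-Reasoning
      q r : ℕ
      q = l / suc m
      r = l % suc m
      r≤m : r ℕ.≤ m
      r≤m = ℕ.≤-pred (m%n<n l (suc m))

    remainder : (Fin N → ℕ) → Fin N → ℕ
    remainder l j = if isPrimed M j then m ℕ.∸ l j % suc m else l j % suc m

    [1+m]*-expo : ∀ l j → + suc m * - expo ⌊ l / suc m ⌋ j ≡ - expo l j + + remainder l j
    [1+m]*-expo l j with isPrimed M j
    ... | true  = trans (sym (ℤ.pos-* (suc m) _)) (trans (cong +_ ([1+m]*[1+l/[1+m]] (l j))) (ℤ.pos-+ (suc (l j)) _))
    ... | false = begin
      + suc m * - + q                    ≡⟨ solve 3 (λ p q r → p :* (:- q) := :- (r :+ q :* p) :+ r)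
                                                    refl (+ suc m) (+ q) (+ r) ⟩
      - (+ r + + q * + suc m) + + r       ≡⟨ cong (λ t → - t + + r) l≡r+qp ⟨
      - + l j + + r                      ∎
      where
      open ≡-Reasoning
      q r : ℕ
      q = l j / suc m
      r = l j % suc m
      l≡r+qp : + l j ≡ + r + + q * + suc m
      l≡r+qp = trans (cong +_ (m≡m%n+[m/n]*n (l j) (suc m)))
                     (trans (ℤ.pos-+ r _) (cong (_+_ (+ r)) (ℤ.pos-* q (suc m))))

    -- For u′ = ∑_j expo ⌊l/(1+m)⌋_j a_j one has (1+m)·(−u′) = −u + ∑_j remainder_j a_j, where the
    -- remainders are ≥ 0 and vanish off σ_β; hence −u′ ∈ σ_β°.
    Index-floor : ∀ {u l} → InMβ u → Index u l
                → InMβ (lin (expo ⌊ l / suc m ⌋) A) × Index (lin (expo ⌊ l / suc m ⌋) A) ⌊ l / suc m ⌋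
    Index-floor {u} {l} (_ , -u∈σ°) (l∈E , lin≡u) = ((expo q , λ i → refl) , -u′∈σ°) , q∈E , λ i → refl
      where
      q c : Fin N → ℕ
      q = ⌊ l / suc m ⌋
      c = remainder l
      C : Fin N → ℤ
      C j = + c j
      q∈E : InE q
      q∈E j aj∉σ = trans (cong (_/ suc m) (l∈E j aj∉σ)) (0/n≡0 (suc m))
      scaled : ∀ i → + suc m * - lin (expo q) A i ≡ - u i + lin C A i
      scaled i = begin
        + suc m * - lin (expo q) A i                ≡⟨ cong (+ suc m *_) (neg-lin A (expo q) i) ⟩
        + suc m * lin (λ j → - expo q j) A i        ≡⟨ *-lin A (+ suc m) (λ j → - expo q j) i ⟩
        lin (λ j → + suc m * - expo q j) A i        ≡⟨ lin-cong A ([1+m]*-expo l) i ⟩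
        lin (λ j → - expo l j + C j) A i            ≡⟨ lin-+ A (λ j → - expo l j) C i ⟩
        lin (λ j → - expo l j) A i + lin C A i      ≡⟨ cong (_+ lin C A i) (neg-lin A (expo l) i) ⟨
        - lin (expo l) A i + lin C A i              ≡⟨ cong (λ t → - t + lin C A i) (lin≡u i) ⟩
        - u i + lin C A i                           ∎
        where open ≡-Reasoning
      c-on-faces : ∀ j w → Dual w → InFace w β → c j ≡ 0 ⊎ dot w (A j) ≡ + 0
      c-on-faces j w dual-w β∈face with isPrimed M j in j-primed
      ... | true  = inj₂ (primed-on-faces w dual-w β∈face j j-primed)
      ... | false with dot w (A j) ≟ + 0
      ...   | yes waj≡0 = inj₂ waj≡0
      ...   | no  waj≢0 = inj₁ (cong (_% suc m) (l∈E j λ aj∈σ → waj≢0 (proj₂ (proj₂ aj∈σ w dual-w β∈face))))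
      -u′∈σ° : InSigmaInt (λ i → - lin (expo q) A i)
      -u′∈σ° = InSigmaInt-divide m -u∈σ° (lin-InSigma c c-on-faces) scaled

module Coefficients {n N : ℕ} (A : Fin N → Vecℤ n) (M : ℕ) where

  open import Data.Nat as ℕ using (suc; _!; _≤_)
  import Data.Nat.Properties as ℕ
  open import Data.Nat.Divisibility using (_∣_; divides)
  open import Data.Integer as ℤ using (ℤ; +_; _+_; _*_; -_)
  import Data.Integer.Properties as ℤ
  open import Data.Integer.GCD using (gcd)
  open import Data.Rational as ℚ using (0ℚ; ↥_)
  import Data.Rational.Properties as ℚ
  open import Data.Rational.Unnormalised using (mkℚᵘ; *≡*)
  open import Data.Bool using (true; false; if_then_else_)
  open import Data.Product using (Σ; _,_)
  open import Data.Sum using ([_,_]′)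
  open import Function using (_∘_)
  open import Relation.Binary.PropositionalEquality
  open Sums

  *-/-cancel : ∀ i d .{{_ : NonZero d}} → (i * + d) ℚ./ d ≡ i ℚ./ 1
  *-/-cancel i (suc d) = ℚ.fromℚᵘ-cong {mkℚᵘ (i * + suc d) d} {mkℚᵘ i 0} (*≡* (ℤ.*-identityʳ (i * + suc d)))

  open Setup A M

  numerArg : (Fin N → ℕ) → Fin N → ℕ
  numerArg l j = if isPrimed M j then l j else 0

  sign : (Fin N → ℕ) → ℤ
  sign l = (- + 1) ℤ.^ ∑ℕ (numerArg l)

  sign≢0 : ∀ l → sign l ≢ + 0
  sign≢0 l sign≡0 with ℤ.i^n≡0⇒i≡0 (- + 1) (∑ℕ (numerArg l)) sign≡0
  ... | ()

  coeff≢0 : ∀ l → coeff l ≢ 0ℚ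
  coeff≢0 l coeff≡0 = [ sign≢0 l , numer≢0 ]′ (ℤ.i*j≡0⇒i≡0∨j≡0 (sign l) numerator≡0)
    where
    instance
      den≢0 : NonZero (∏ (λ j → denomArg l j !))
      den≢0 = ∏!≢0 (denomArg l)
    numerator≡0 : sign l * + numer l ≡ + 0
    numerator≡0 = trans (sym (ℚ.↥-/ (sign l * + numer l) (∏ (λ j → denomArg l j !))))
                        (cong (λ q → ↥ q * gcd (sign l * + numer l) (+ ∏ (λ j → denomArg l j !))) coeff≡0)
    numer≢0 : + numer l ≢ + 0
    numer≢0 = ℕ.≢-nonZero⁻¹ (numer l) {{∏!≢0 (numerArg l)}} ∘ ℤ.+-injective

  coeff-integral : ∀ l → ∏ (λ j → denomArg l j !) ∣ numer l → Σ ℤ λ z → coeff l ≡ z ℚ./ 1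
  coeff-integral l (divides t numer≡t*den) = sign l * + t , (begin
    coeff l                                  ≡⟨ cong (λ k → (sign l * + k) ℚ./ den) numer≡t*den ⟩
    (sign l * + (t ℕ.* den)) ℚ./ den         ≡⟨ cong (ℚ._/ den) (trans (cong (sign l *_) (ℤ.pos-* t den))
                                                                        (sym (ℤ.*-assoc (sign l) (+ t) (+ den)))) ⟩
    (sign l * + t * + den) ℚ./ den           ≡⟨ *-/-cancel (sign l * + t) den ⟩
    (sign l * + t) ℚ./ 1                     ∎)
    where
    open ≡-Reasoning
    den : ℕ
    den = ∏ (λ j → denomArg l j !)
    instance
      den≢0 : NonZero (∏ (λ j → denomArg l j !))
      den≢0 = ∏!≢0 (denomArg l)

  module _ {t : Fin n} (A-t≡1 : ∀ j → A j t ≡ + 1) (M≤N : M ≤ N) where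

    primed : Fin N → ℕ
    primed j = if isPrimed M j then 1 else 0

    -expo+denom : ∀ l j → - expo l j + + denomArg l j ≡ + primed j + + numerArg l j
    -expo+denom l j with isPrimed M j
    ... | true  = ℤ.+-identityʳ (+ suc (l j))
    ... | false = ℤ.+-inverseˡ (+ l j)

    -u[t]+∑denom≡M+∑numer : ∀ {u l} → Index u l → - u t + + ∑ℕ (denomArg l) ≡ + M + + ∑ℕ (numerArg l)
    -u[t]+∑denom≡M+∑numer {u} {l} (_ , lin≡u) = begin
      - u t + + ∑ℕ (denomArg l)                            ≡⟨ cong₂ (λ x y → - x + y) (sym (lin≡u t)) (pos-∑ℕ (denomArg l)) ⟩
      - lin (expo l) A t + ∑ (λ j → + denomArg l j)        ≡⟨ cong (λ x → - x + ∑ (λ j → + denomArg l j)) ∑expo ⟩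
      - ∑ (expo l) + ∑ (λ j → + denomArg l j)              ≡⟨ cong (_+ ∑ (λ j → + denomArg l j)) (neg-distrib-∑ (expo l)) ⟩
      ∑ (λ j → - expo l j) + ∑ (λ j → + denomArg l j)      ≡⟨ ∑-distrib-+ (λ j → - expo l j) (λ j → + denomArg l j) ⟨
      ∑ (λ j → - expo l j + + denomArg l j)                ≡⟨ ∑-cong (-expo+denom l) ⟩
      ∑ (λ j → + primed j + + numerArg l j)                ≡⟨ ∑-distrib-+ (λ j → + primed j) (λ j → + numerArg l j) ⟩
      ∑ (λ j → + primed j) + ∑ (λ j → + numerArg l j)      ≡⟨ cong₂ _+_ (pos-∑ℕ primed) (pos-∑ℕ (numerArg l)) ⟨
      + ∑ℕ primed + + ∑ℕ (numerArg l)                      ≡⟨ cong (λ k → + k + + ∑ℕ (numerArg l)) (#primed≡M M M≤N) ⟩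
      + M + + ∑ℕ (numerArg l)                              ∎
      where
      open ≡-Reasoning
      ∑expo : lin (expo l) A t ≡ ∑ (expo l)
      ∑expo = ∑-cong (λ j → trans (cong (expo l j *_) (A-t≡1 j)) (ℤ.*-identityʳ (expo l j)))

    ∑denom≤∑numer : ∀ {u l} → + M ℤ.≤ - u t → Index u l → ∑ℕ (denomArg l) ≤ ∑ℕ (numerArg l)
    ∑denom≤∑numer {u} {l} M≤-u[t] l-index = ℕ.+-cancelˡ-≤ M _ _ (ℤ.drop‿+≤+ (begin
      + (M ℕ.+ ∑ℕ (denomArg l))   ≡⟨ ℤ.pos-+ M (∑ℕ (denomArg l)) ⟩
      + M + + ∑ℕ (denomArg l)     ≤⟨ ℤ.+-monoˡ-≤ (+ ∑ℕ (denomArg l)) M≤-u[t] ⟩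
      - u t + + ∑ℕ (denomArg l)   ≡⟨ -u[t]+∑denom≡M+∑numer l-index ⟩
      + M + + ∑ℕ (numerArg l)     ≡⟨ ℤ.pos-+ M (∑ℕ (numerArg l)) ⟨
      + (M ℕ.+ ∑ℕ (numerArg l))   ∎))
      where open ℤ.≤-Reasoning

module Integrality {n N : ℕ} (A : Fin N → Vecℤ n) (M : ℕ) where

  open import Data.Nat using (suc; _≤_)
  open import Data.Nat.DivMod using (0/n≡0)
  open import Data.Nat.Primality using (Prime; prime⇒nonZero)
  open import Data.Integer as ℤ using (+_; -_)
  open import Data.Bool using (true; false)
  open import Data.Product using (∃₂; _×_; _,_; proj₁; proj₂)
  open import Relation.Binary.PropositionalEquality
  open Setup A M
  open Sums using (∑ℕ-cong)
  open FactorialQuotients using (∏!∣∏!)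
  open Faces A M using (Index-floor)
  open Coefficients A M

  Ratio : (Fin N → ℕ) → (Fin N → ℕ) → Set
  Ratio a b = ∃₂ λ u l → InMβ u × Index u l × a ≗ numerArg l × b ≗ denomArg l

  Ratio-floor : ∀ {p} (p-prime : Prime p) {a b} → Ratio a b
              → Ratio (⌊ a / p ⌋ {{prime⇒nonZero p-prime}}) (⌊ b / p ⌋ {{prime⇒nonZero p-prime}})
  Ratio-floor {suc m} _ {a} {b} (u , l , u∈Mβ , l-index , a≗ , b≗) =
    _ , ⌊ l / suc m ⌋ , proj₁ floor-step , proj₂ floor-step , numer≗ , denom≗
    where
    floor-step : InMβ (lin (expo ⌊ l / suc m ⌋) A) × Index (lin (expo ⌊ l / suc m ⌋) A) ⌊ l / suc m ⌋
    floor-step = Index-floor m u∈Mβ l-index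
    numer≗ : ∀ j → a j / suc m ≡ numerArg ⌊ l / suc m ⌋ j
    numer≗ j with isPrimed M j | a≗ j
    ... | true  | aj≡ = cong (_/ suc m) aj≡
    ... | false | aj≡ = trans (cong (_/ suc m) aj≡) (0/n≡0 (suc m))
    denom≗ : ∀ j → b j / suc m ≡ denomArg ⌊ l / suc m ⌋ j
    denom≗ j with isPrimed M j | b≗ j
    ... | true  | bj≡ = trans (cong (_/ suc m) bj≡) (0/n≡0 (suc m))
    ... | false | bj≡ = cong (_/ suc m) bj≡

  module _ {t : Fin n} (A-t≡1 : ∀ j → A j t ≡ + 1) (M≤N : M ≤ N)
           (M≤-u[t] : ∀ u → InMβ u → FNonzero u → + M ℤ.≤ - u t) where

    Ratio-∑≤ : ∀ {a b} → Ratio a b → ∑ℕ b ≤ ∑ℕ a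
    Ratio-∑≤ (u , l , u∈Mβ , l-index , a≗ , b≗) = subst₂ _≤_ (sym (∑ℕ-cong b≗)) (sym (∑ℕ-cong a≗))
      (∑denom≤∑numer A-t≡1 M≤N (M≤-u[t] u u∈Mβ (l , l-index , coeff≢0 l)) l-index)

    integral-coefficients : ∀ u → InMβ u → IntegralCoeffs u
    integral-coefficients u u∈Mβ l l-index =
      coeff-integral l (∏!∣∏! Ratio Ratio-floor Ratio-∑≤ (u , l , u∈Mβ , l-index , (λ _ → refl) , (λ _ → refl)))

open import Data.Nat using (suc; _≤_)
open import Data.Integer as ℤ using (+_)
open import Data.Fin using (fromℕ)
open import Data.Product using (Σ; _×_)
open import Relation.Binary.PropositionalEquality using (_≡_; _≢_)
open import Relation.Nullary using (¬_)

theorem2p10 : (k N M : ℕ) → 1 ≤ M → M ≤ N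
    → (A : Fin N → Vecℤ (suc k))
    → (∀ i j → i ≢ j → ¬ (∀ t → A i t ≡ A j t))
    → (∀ j → A j (fromℕ k) ≡ + 1)
    → Setup.MinimalFor A M
    → (Σ (Vecℤ (suc k)) λ u → Setup.InMβ A M u × Setup.FNonzero A M u × ℤ.- u (fromℕ k) ≡ + M)
    → (∀ u → Setup.InMβ A M u → Setup.FNonzero A M u → + M ℤ.≤ ℤ.- u (fromℕ k))
    → ∀ u → Setup.InMβ A M u → Setup.IntegralCoeffs A M u
theorem2p10 k N M _ M≤N A _ last≡1 _ _ M≤-u[last] = Integrality.integral-coefficients A M last≡1 M≤N M≤-u[last]
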